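{- Let $s$ be a Bosbach state on a bounded pseudo-BCK algebra $A$. Then for all $x,y\in A$: (1) $s(x\vee_1 y)=s(x\vee_2 y)$; (2) $s(x\rightarrow y)=s(x\rightsquigarrow y)$.
   Context: A pseudo-BCK algebra is a structure $(A,\le,\rightarrow,\rightsquigarrow,1)$ with $\le$ a binary relation, $\rightarrow,\rightsquigarrow$ binary operations and $1\in A$, such that for all $x,y,z\in A$: $x\rightarrow y\le (y\rightarrow z)\rightsquigarrow(x\rightarrow z)$ and $x\rightsquigarrow y\le (y\rightsquigarrow z)\rightarrow(x\rightsquigarrow z)$; $x\le (x\rightarrow y)\rightsquigarrow y$ and $x\le (x\rightsquigarrow y)\rightarrow y$; $x\le x$; $x\le 1$; antisymmetry of $\le$; $x\le y$ iff $x\rightarrow y=1$ iff $x\rightsquigarrow y=1$. It is bounded if it has a least element $0$. $x\vee_1 y=(x\rightarrow y)\rightsquigarrow y$, $x\vee_2 y=(x\rightsquigarrow y)\rightarrow y$. A Bosbach state is a map $s:A\to[0,1]$ with $s(x)+s(x\rightarrow y)=s(y)+s(y\rightarrow x)$, $s(x)+s(x\rightsquigarrow y)=s(y)+s(y\rightsquigarrow x)$ for all $x,y$, $s(0)=0$, $s(1)=1$. -}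

module Defs where

open import Level using (Level; _⊔_; suc)
open import Data.Product using (Σ; _×_; ∃)
open import Data.Sum using (_⊎_)
open import Relation.Nullary using (¬_)
open import Relation.Binary.PropositionalEquality using (_≡_)
open import Relation.Binary.Core using (Rel)
open import Relation.Unary using (Pred)
open import Algebra.Bundles using (CommutativeRing)

-- The real numbers, axiomatised as a complete ordered field
-- (agda-stdlib has no real numbers; any model of these axioms is ℝ up
-- to isomorphism, and the theorem is stated for every such model).

record RealNumbers (c ℓ : Level) : Set (suc (c ⊔ ℓ)) where
  field
    commRing : CommutativeRing c ℓ
  open CommutativeRing commRing public
  field
    _≤ᵣ_     : Rel Carrier ℓ
    ≤-refl   : ∀ {x y} → x ≈ y → x ≤ᵣ y
    ≤-trans  : ∀ {x y z} → x ≤ᵣ y → y ≤ᵣ z → x ≤ᵣ z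
    ≤-antisym : ∀ {x y} → x ≤ᵣ y → y ≤ᵣ x → x ≈ y
    ≤-total  : ∀ x y → (x ≤ᵣ y) ⊎ (y ≤ᵣ x)
    ≤-resp-≈ : ∀ {x x′ y y′} → x ≈ x′ → y ≈ y′ → x ≤ᵣ y → x′ ≤ᵣ y′
    +-mono-≤ : ∀ {x y} z → x ≤ᵣ y → (x + z) ≤ᵣ (y + z)
    *-nonneg : ∀ {x y} → 0# ≤ᵣ x → 0# ≤ᵣ y → 0# ≤ᵣ (x * y)
    0≉1      : ¬ (0# ≈ 1#)
    inverse  : ∀ x → ¬ (x ≈ 0#) → Σ Carrier (λ y → (x * y) ≈ 1#)
    complete : (P : Pred Carrier ℓ) →
               (∀ {x y} → x ≈ y → P x → P y) →
               ∃ P →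
               Σ Carrier (λ b → ∀ x → P x → x ≤ᵣ b) →
               Σ Carrier (λ u → (∀ x → P x → x ≤ᵣ u) ×
                                (∀ b → (∀ x → P x → x ≤ᵣ b) → u ≤ᵣ b))

record PseudoBCK (a ℓ : Level) : Set (suc (a ⊔ ℓ)) where
  infixr 5 _⇒_ _⇝_
  infix 4 _≤_
  field
    A    : Set a
    _≤_  : Rel A ℓ
    _⇒_  : A → A → A
    _⇝_  : A → A → A
    one  : A
    ax1  : ∀ x y z → (x ⇒ y) ≤ ((y ⇒ z) ⇝ (x ⇒ z))
    ax1′ : ∀ x y z → (x ⇝ y) ≤ ((y ⇝ z) ⇒ (x ⇝ z))
    ax2  : ∀ x y → x ≤ ((x ⇒ y) ⇝ y)
    ax2′ : ∀ x y → x ≤ ((x ⇝ y) ⇒ y)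
    refl≤ : ∀ x → x ≤ x
    le-one : ∀ x → x ≤ one
    antisym : ∀ {x y} → x ≤ y → y ≤ x → x ≡ y
    ≤⇒⇒ : ∀ {x y} → x ≤ y → (x ⇒ y) ≡ one
    ⇒⇒≤ : ∀ {x y} → (x ⇒ y) ≡ one → x ≤ y
    ≤⇒⇝ : ∀ {x y} → x ≤ y → (x ⇝ y) ≡ one
    ⇝⇒≤ : ∀ {x y} → (x ⇝ y) ≡ one → x ≤ y

  _∨₁_ : A → A → A
  x ∨₁ y = (x ⇒ y) ⇝ y

  _∨₂_ : A → A → A
  x ∨₂ y = (x ⇝ y) ⇒ y

record BoundedPseudoBCK (a ℓ : Level) : Set (suc (a ⊔ ℓ)) where
  field
    pbck : PseudoBCK a ℓ
  open PseudoBCK pbck public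
  field
    zero    : A
    zero-le : ∀ x → zero ≤ x

record BosbachState {a ℓa c ℓ : Level} (ℝ : RealNumbers c ℓ)
       (B : BoundedPseudoBCK a ℓa) (s : BoundedPseudoBCK.A B → RealNumbers.Carrier ℝ)
       : Set (a ⊔ ℓ) where
  open RealNumbers ℝ
  open BoundedPseudoBCK B renaming (_≤_ to _≤A_; one to oneA; zero to zeroA)
  field
    in-unit : ∀ x → (0# ≤ᵣ s x) × (s x ≤ᵣ 1#)
    bosbach₁ : ∀ x y → (s x + s (x ⇒ y)) ≈ (s y + s (y ⇒ x))
    bosbach₂ : ∀ x y → (s x + s (x ⇝ y)) ≈ (s y + s (y ⇝ x))
    s-zero : s zeroA ≈ 0#
    s-one  : s oneA ≈ 1#

-- Everything rests on one consequence of the Bosbach identity: when y ≤ z,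
-- the value s(z → y) is pinned down by s z, namely s z + s(z → y) = s y + 1
-- (and likewise for ⇝).  It makes s monotone, and applied to z = x → y and
-- z = x ∨₁ y (both above y) it gives s(x ∨₁ y ⇝ y) = s(x → y).  Since x ≤ x ∨₁ y,
-- antitonicity of ⇝ and monotonicity of s then yield s(x → y) ≤ s(x ⇝ y).
--
-- Every axiom system involved is symmetric under swapping → with ⇝, so we
-- define the opposite algebra and the opposite state and obtain each mirrored
-- statement (in particular s(x ⇝ y) ≤ s(x → y)) for free.  Antisymmetry gives
-- part (2); part (1) follows because s(x → y) + s(x ∨₁ y) and
-- s(x ⇝ y) + s(x ∨₂ y) both equal s y + 1.
module Submission where

open import Defs
open import Data.Product using (_×_; _,_; proj₂)
open import Relation.Binary.PropositionalEquality as P using (_≡_)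
import Algebra.Properties.Group as GroupProperties
import Relation.Binary.Reasoning.Setoid as SetoidReasoning

module RealArithmetic {c ℓ} (ℝ : RealNumbers c ℓ) where
  open RealNumbers ℝ
  open GroupProperties +-group using (∙-cancelˡ; ∙-cancelʳ)
  open SetoidReasoning setoid

  same-total-cancelʳ : ∀ {a a′ b e} → a + b ≈ e → a′ + b ≈ e → a ≈ a′
  same-total-cancelʳ {a} {a′} {b} p q = ∙-cancelʳ b a a′ (trans p (sym q))

  same-total-cancelˡ : ∀ {a a′ b b′ e} → a + b ≈ e → a′ + b′ ≈ e → a ≈ a′ → b ≈ b′
  same-total-cancelˡ {a} {a′} {b} {b′} p q a≈a′ =
    ∙-cancelˡ a b b′ (trans p (sym (trans (+-cong a≈a′ refl) q)))

  +-cancelʳ-≤ : ∀ {a b} c → (a + c) ≤ᵣ (b + c) → a ≤ᵣ b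
  +-cancelʳ-≤ c p = ≤-resp-≈ (undo _) (undo _) (+-mono-≤ (- c) p)
    where
      undo : ∀ z → (z + c) + - c ≈ z
      undo z = begin
        (z + c) + - c  ≈⟨ +-assoc z c (- c) ⟩
        z + (c + - c)  ≈⟨ +-cong refl (-‿inverseʳ c) ⟩
        z + 0#         ≈⟨ +-identityʳ z ⟩
        z              ∎

  ≤-from-balance : ∀ {a b t u} → a + u ≈ b + t → t ≤ᵣ u → a ≤ᵣ b
  ≤-from-balance {a} {b} {t} {u} balance t≤u =
    +-cancelʳ-≤ u (≤-resp-≈ (sym balance) refl
      (≤-resp-≈ (+-comm t b) (+-comm u b) (+-mono-≤ b t≤u)))

opposite : ∀ {a ℓ} → PseudoBCK a ℓ → PseudoBCK a ℓ
opposite 𝒜 = record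
  { A = A ; _≤_ = _≤_ ; _⇒_ = _⇝_ ; _⇝_ = _⇒_ ; one = one
  ; ax1 = ax1′ ; ax1′ = ax1 ; ax2 = ax2′ ; ax2′ = ax2
  ; refl≤ = refl≤ ; le-one = le-one ; antisym = antisym
  ; ≤⇒⇒ = ≤⇒⇝ ; ⇒⇒≤ = ⇝⇒≤ ; ≤⇒⇝ = ≤⇒⇒ ; ⇝⇒≤ = ⇒⇒≤
  }
  where open PseudoBCK 𝒜

oppositeBounded : ∀ {a ℓ} → BoundedPseudoBCK a ℓ → BoundedPseudoBCK a ℓ
oppositeBounded B = record { pbck = opposite pbck ; zero = zero ; zero-le = zero-le }
  where open BoundedPseudoBCK B

oppositeState : ∀ {a ℓa c ℓ} {ℝ : RealNumbers c ℓ} {B : BoundedPseudoBCK a ℓa}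
  {s : BoundedPseudoBCK.A B → RealNumbers.Carrier ℝ} →
  BosbachState ℝ B s → BosbachState ℝ (oppositeBounded B) s
oppositeState st = record
  { in-unit = in-unit ; bosbach₁ = bosbach₂ ; bosbach₂ = bosbach₁
  ; s-zero = s-zero ; s-one = s-one
  }
  where open BosbachState st

module PseudoBCKOrder {a ℓ} (𝒜 : PseudoBCK a ℓ) where
  open PseudoBCK 𝒜

  one-maximal : ∀ {w} → one ≤ w → w ≡ one
  one-maximal {w} one≤w = antisym (le-one w) one≤w

  -- From axiom (1): if x ≤ y then x → y = 1, so 1 ≤ (y → z) ⇝ (x → z).
  ⇒-antitoneˡ : ∀ {x y} z → x ≤ y → (y ⇒ z) ≤ (x ⇒ z)
  ⇒-antitoneˡ {x} {y} z x≤y =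
    ⇝⇒≤ (one-maximal (P.subst (λ t → t ≤ ((y ⇒ z) ⇝ (x ⇒ z))) (≤⇒⇒ x≤y) (ax1 x y z)))

  -- Transitivity is not an axiom; it follows from antitonicity of →.
  ≤-trans : ∀ {x y z} → x ≤ y → y ≤ z → x ≤ z
  ≤-trans {x} {y} {z} x≤y y≤z =
    ⇒⇒≤ (one-maximal (P.subst (λ t → t ≤ (x ⇒ z)) (≤⇒⇒ y≤z) (⇒-antitoneˡ z x≤y)))

  -- y ≤ (y ⇝ y) → y = 1 → y ≤ x → y.
  y≤x⇒y : ∀ x y → y ≤ (x ⇒ y)
  y≤x⇒y x y = ≤-trans y≤one⇒y (⇒-antitoneˡ y (le-one x))
    where
      y≤one⇒y : y ≤ (one ⇒ y)
      y≤one⇒y = P.subst (λ t → y ≤ (t ⇒ y)) (≤⇒⇝ (refl≤ y)) (ax2′ y y)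

module BosbachBasic {a ℓa c ℓ} {ℝ : RealNumbers c ℓ} {B : BoundedPseudoBCK a ℓa}
  {s : BoundedPseudoBCK.A B → RealNumbers.Carrier ℝ} (st : BosbachState ℝ B s) where
  open RealNumbers ℝ
  open BoundedPseudoBCK B renaming (_≤_ to _≤A_)
  open BosbachState st
  open RealArithmetic ℝ

  s-at-one : ∀ {w} → w ≡ one → s w ≈ 1#
  s-at-one w≡one = trans (reflexive (P.cong s w≡one)) s-one

  complement⇒ : ∀ {y z} → y ≤A z → s z + s (z ⇒ y) ≈ s y + 1#
  complement⇒ {y} {z} y≤z =
    trans (sym (bosbach₁ y z)) (+-cong refl (s-at-one (≤⇒⇒ y≤z)))

  -- States are monotone, since s(y → x) ≤ 1.
  monotone : ∀ {x y} → x ≤A y → s x ≤ᵣ s y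
  monotone {x} {y} x≤y =
    ≤-from-balance (sym (complement⇒ x≤y)) (proj₂ (in-unit (y ⇒ x)))

module BosbachJoin {a ℓa c ℓ} {ℝ : RealNumbers c ℓ} {B : BoundedPseudoBCK a ℓa}
  {s : BoundedPseudoBCK.A B → RealNumbers.Carrier ℝ} (st : BosbachState ℝ B s) where
  open RealNumbers ℝ
  open BoundedPseudoBCK B
  open RealArithmetic ℝ
  open PseudoBCKOrder pbck using (y≤x⇒y)
  open PseudoBCKOrder (opposite pbck) using ()
    renaming (y≤x⇒y to y≤x⇝y; ⇒-antitoneˡ to ⇝-antitoneˡ)
  open BosbachBasic st using (monotone)
  open BosbachBasic (oppositeState st) using () renaming (complement⇒ to complement⇝)

  -- x ∨₁ y = (x → y) ⇝ y, with y ≤ x → y.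
  ⇒-∨₁-total : ∀ x y → s (x ⇒ y) + s (x ∨₁ y) ≈ s y + 1#
  ⇒-∨₁-total x y = complement⇝ (y≤x⇒y x y)

  -- Both s(x → y) and s(x ∨₁ y ⇝ y) complete s(x ∨₁ y) to s y + 1.
  ∨₁-⇝-recovers-⇒ : ∀ x y → s ((x ∨₁ y) ⇝ y) ≈ s (x ⇒ y)
  ∨₁-⇝-recovers-⇒ x y = same-total-cancelʳ
    (trans (+-comm _ _) (complement⇝ (y≤x⇝y (x ⇒ y) y)))
    (⇒-∨₁-total x y)

  -- x ≤ x ∨₁ y, hence x ∨₁ y ⇝ y ≤ x ⇝ y.
  ⇒≤⇝ : ∀ x y → s (x ⇒ y) ≤ᵣ s (x ⇝ y)
  ⇒≤⇝ x y = ≤-resp-≈ (∨₁-⇝-recovers-⇒ x y) refl (monotone (⇝-antitoneˡ y (ax2 x y)))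

proposition3p7 : ∀ {a ℓa c ℓ} (ℝ : RealNumbers c ℓ) (B : BoundedPseudoBCK a ℓa)
    (s : BoundedPseudoBCK.A B → RealNumbers.Carrier ℝ) →
    BosbachState ℝ B s →
    ∀ x y →
    RealNumbers._≈_ ℝ (s (BoundedPseudoBCK._∨₁_ B x y)) (s (BoundedPseudoBCK._∨₂_ B x y))
    × RealNumbers._≈_ ℝ (s (BoundedPseudoBCK._⇒_ B x y)) (s (BoundedPseudoBCK._⇝_ B x y))
proposition3p7 ℝ B s st x y = join-equal , implications-equal
  where
    open RealNumbers ℝ using (_≈_; ≤-antisym)
    open BoundedPseudoBCK B using (_⇒_; _⇝_; _∨₁_; _∨₂_)
    open RealArithmetic ℝ using (same-total-cancelˡ)
    open BosbachJoin st
    -- the opposite algebra has ⇝ for →, hence ∨₂ for ∨₁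
    open BosbachJoin (oppositeState st) using ()
      renaming (⇒≤⇝ to ⇝≤⇒; ⇒-∨₁-total to ⇝-∨₂-total)

    implications-equal : s (x ⇒ y) ≈ s (x ⇝ y)
    implications-equal = ≤-antisym (⇒≤⇝ x y) (⇝≤⇒ x y)

    join-equal : s (x ∨₁ y) ≈ s (x ∨₂ y)
    join-equal = same-total-cancelˡ (⇒-∨₁-total x y) (⇝-∨₂-total x y) implications-equal
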